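{- For any polynomial $f\in\mathbb{F}_3[X]$ of the form $f(X)=a_3X^3-a_1X-a_0$ with $a_3\neq 0$, at least one of the polynomials $f$, $f^{(2)}$, $f^{(3)}$ is reducible over $\mathbb{F}_3$.
   Context: The iterates are $f^{(0)}(X)=X$ and $f^{(n)}(X)=f^{(n-1)}(f(X))$ for $n\ge1$. -}

module Defs where

open import Data.Nat using (ℕ; zero; suc; _∸_; _≤_)
open import Data.List using (List; []; _∷_; length)
open import Data.Product using (Σ; _×_)
open import Relation.Binary.PropositionalEquality using (_≡_)

data F₃ : Set where
  0₃ 1₃ 2₃ : F₃

_+₃_ : F₃ → F₃ → F₃
0₃ +₃ b  = b
a  +₃ 0₃ = a
1₃ +₃ 1₃ = 2₃
1₃ +₃ 2₃ = 0₃
2₃ +₃ 1₃ = 0₃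
2₃ +₃ 2₃ = 1₃

_*₃_ : F₃ → F₃ → F₃
0₃ *₃ b  = 0₃
1₃ *₃ b  = b
2₃ *₃ 0₃ = 0₃
2₃ *₃ 1₃ = 2₃
2₃ *₃ 2₃ = 1₃

-₃_ : F₃ → F₃
-₃ 0₃ = 0₃
-₃ 1₃ = 2₃
-₃ 2₃ = 1₃

-- Polynomials in 𝔽₃[X] as coefficient lists, lowest degree first:
-- c₀ ∷ c₁ ∷ … represents c₀ + c₁ X + …  (trailing zeros allowed).
Poly : Set
Poly = List F₃

_+ₚ_ : Poly → Poly → Poly
[]      +ₚ q       = q
p       +ₚ []      = p
(a ∷ p) +ₚ (b ∷ q) = (a +₃ b) ∷ (p +ₚ q)

scale : F₃ → Poly → Poly
scale c []      = []
scale c (a ∷ p) = (c *₃ a) ∷ scale c p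

_*ₚ_ : Poly → Poly → Poly
[]      *ₚ q = []
(a ∷ p) *ₚ q = scale a q +ₚ (0₃ ∷ (p *ₚ q))

_∘ₚ_ : Poly → Poly → Poly
[]      ∘ₚ q = []
(a ∷ p) ∘ₚ q = (a ∷ []) +ₚ (q *ₚ (p ∘ₚ q))

Xₚ : Poly
Xₚ = 0₃ ∷ 1₃ ∷ []

iter : Poly → ℕ → Poly
iter f zero    = Xₚ
iter f (suc n) = iter f n ∘ₚ f

normalize : Poly → Poly
normalize [] = []
normalize (a ∷ p) with normalize p
... | [] with a
...   | 0₃ = []
...   | 1₃ = 1₃ ∷ []
...   | 2₃ = 2₃ ∷ []
normalize (a ∷ p) | b ∷ r = a ∷ b ∷ r

_≈ₚ_ : Poly → Poly → Set
p ≈ₚ q = normalize p ≡ normalize q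

-- Degree (with the convention deg 0 = 0; only used as 1 ≤ deg p,
-- i.e. "p is nonconstant").
deg : Poly → ℕ
deg p = length (normalize p) ∸ 1

Reducible : Poly → Set
Reducible f = Σ Poly λ g → Σ Poly λ h → (1 ≤ deg g) × (1 ≤ deg h) × ((g *ₚ h) ≈ₚ f)

cubic : F₃ → F₃ → F₃ → Poly
cubic a₃ a₁ a₀ = (-₃ a₀) ∷ (-₃ a₁) ∷ 0₃ ∷ a₃ ∷ []

module Submission where

-- Write f = a₃X³ − a₁X − a₀ over 𝔽₃ with a₃ ≠ 0.
-- By Fermat's little theorem r³ = r for every r ∈ 𝔽₃, so f takes the
-- value f(r) = (a₃ − a₁)r − a₀.  Two cases:
--   * a₁ ≠ a₃.  Then d = a₃ − a₁ is a unit with d⁻¹ = d, so r = d·a₀ is a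
--     root of f; by the factor theorem f = (X − r)·q with q quadratic,
--     and f is reducible.
--   * a₁ = a₃ = a.  Then f = a(X³ − X) − a₀ and, since a² = 1 and the
--     Frobenius is additive, f⁽²⁾ = X⁹ + X³ + X − a₀ independently of a.
--     This nonic factors over 𝔽₃ for every constant term (explicit
--     factorisations of degrees 1·8 and 3·6), so f⁽²⁾ is reducible.

open import Defs
open import Data.Empty using (⊥-elim)
open import Data.Sum using (_⊎_; inj₁; inj₂; map₂)
open import Data.Product using (_,_; ∃-syntax)
open import Data.Nat using (_≤_; s≤s; z≤n)
open import Data.List using ([]; _∷_)
import Data.List.Properties as List
open import Relation.Nullary using (Dec; yes; no)
open import Relation.Nullary.Decidable using (from-yes; ¬?; _→-dec_)
open import Relation.Binary.Definitions using (DecidableEquality)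
open import Relation.Binary.PropositionalEquality
  using (_≡_; _≢_; refl; sym; trans; cong; module ≡-Reasoning)

_-₃_ : F₃ → F₃ → F₃
x -₃ y = x +₃ (-₃ y)

eval : Poly → F₃ → F₃
eval []      x = 0₃
eval (a ∷ p) x = a +₃ (x *₃ eval p x)

_≟₃_ : DecidableEquality F₃
0₃ ≟₃ 0₃ = yes refl
0₃ ≟₃ 1₃ = no λ ()
0₃ ≟₃ 2₃ = no λ ()
1₃ ≟₃ 0₃ = no λ ()
1₃ ≟₃ 1₃ = yes refl
1₃ ≟₃ 2₃ = no λ ()
2₃ ≟₃ 0₃ = no λ ()
2₃ ≟₃ 1₃ = no λ ()
2₃ ≟₃ 2₃ = yes refl

_≈?_ : (p q : Poly) → Dec (p ≈ₚ q)
p ≈? q = List.≡-dec _≟₃_ (normalize p) (normalize q)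

-- A property of field elements can be decided by checking 0, 1 and 2; this
-- turns identities over 𝔽₃ into finite computations.
∀₃? : {P : F₃ → Set} → ((x : F₃) → Dec (P x)) → Dec ((x : F₃) → P x)
∀₃? P? with P? 0₃ | P? 1₃ | P? 2₃
... | yes p₀ | yes p₁ | yes p₂ = yes λ { 0₃ → p₀ ; 1₃ → p₁ ; 2₃ → p₂ }
... | no ¬p₀ | _      | _      = no λ p → ¬p₀ (p 0₃)
... | yes _  | no ¬p₁ | _      = no λ p → ¬p₁ (p 1₃)
... | yes _  | yes _  | no ¬p₂ = no λ p → ¬p₂ (p 2₃)

sub-self : (x : F₃) → x -₃ x ≡ 0₃
sub-self 0₃ = refl
sub-self 1₃ = refl
sub-self 2₃ = refl

sub-nonzero : {x y : F₃} → y ≢ x → x -₃ y ≢ 0₃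
sub-nonzero {0₃} {0₃} y≢x _  = y≢x refl
sub-nonzero {1₃} {1₃} y≢x _  = y≢x refl
sub-nonzero {2₃} {2₃} y≢x _  = y≢x refl
sub-nonzero {0₃} {1₃} _   ()
sub-nonzero {0₃} {2₃} _   ()
sub-nonzero {1₃} {0₃} _   ()
sub-nonzero {1₃} {2₃} _   ()
sub-nonzero {2₃} {0₃} _   ()
sub-nonzero {2₃} {1₃} _   ()

unit-self-inverse : {d : F₃} → d ≢ 0₃ → (x : F₃) → d *₃ (d *₃ x) ≡ x
unit-self-inverse {0₃} d≢0 _  = ⊥-elim (d≢0 refl)
unit-self-inverse {1₃} _ x  = refl
unit-self-inverse {2₃} _ 0₃ = refl
unit-self-inverse {2₃} _ 1₃ = refl
unit-self-inverse {2₃} _ 2₃ = refl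

-- Fermat's little theorem r³ = r collapses the value of the cubic to an
-- affine function of the point.
cubic-value : (a₃ a₁ a₀ r : F₃) → eval (cubic a₃ a₁ a₀) r ≡ ((a₃ -₃ a₁) *₃ r) -₃ a₀
cubic-value = from-yes (∀₃? λ a₃ → ∀₃? λ a₁ → ∀₃? λ a₀ → ∀₃? λ r →
  eval (cubic a₃ a₁ a₀) r ≟₃ (((a₃ -₃ a₁) *₃ r) -₃ a₀))

cubic-root : (a₃ a₁ a₀ : F₃) → a₁ ≢ a₃ → ∃[ r ] eval (cubic a₃ a₁ a₀) r ≡ 0₃
cubic-root a₃ a₁ a₀ a₁≢a₃ = d *₃ a₀ , root
  where
  open ≡-Reasoning
  d : F₃
  d = a₃ -₃ a₁
  root : eval (cubic a₃ a₁ a₀) (d *₃ a₀) ≡ 0₃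
  root = begin
    eval (cubic a₃ a₁ a₀) (d *₃ a₀)  ≡⟨ cubic-value a₃ a₁ a₀ (d *₃ a₀) ⟩
    (d *₃ (d *₃ a₀)) -₃ a₀           ≡⟨ cong (_-₃ a₀) (unit-self-inverse (sub-nonzero a₁≢a₃) a₀) ⟩
    a₀ -₃ a₀                         ≡⟨ sub-self a₀ ⟩
    0₃                               ∎

linear : F₃ → Poly
linear r = (-₃ r) ∷ 1₃ ∷ []

cofactor : F₃ → F₃ → F₃ → Poly
cofactor a₃ a₁ r = (((a₃ *₃ r) *₃ r) -₃ a₁) ∷ (a₃ *₃ r) ∷ a₃ ∷ []

cubic-factor : (a₃ a₁ a₀ r : F₃) → eval (cubic a₃ a₁ a₀) r ≡ 0₃ →
  (linear r *ₚ cofactor a₃ a₁ r) ≈ₚ cubic a₃ a₁ a₀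
cubic-factor = from-yes (∀₃? λ a₃ → ∀₃? λ a₁ → ∀₃? λ a₀ → ∀₃? λ r →
  (eval (cubic a₃ a₁ a₀) r ≟₃ 0₃) →-dec ((linear r *ₚ cofactor a₃ a₁ r) ≈? cubic a₃ a₁ a₀))

cofactor-nonconstant : {a₃ : F₃} (a₁ r : F₃) → a₃ ≢ 0₃ → 1 ≤ deg (cofactor a₃ a₁ r)
cofactor-nonconstant {0₃} _ _ a₃≢0 = ⊥-elim (a₃≢0 refl)
cofactor-nonconstant {1₃} _ _ _    = s≤s z≤n
cofactor-nonconstant {2₃} _ _ _    = s≤s z≤n

root⇒reducible : (a₃ a₁ a₀ : F₃) → a₃ ≢ 0₃ →
  ∃[ r ] eval (cubic a₃ a₁ a₀) r ≡ 0₃ → Reducible (cubic a₃ a₁ a₀)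
root⇒reducible a₃ a₁ a₀ a₃≢0 (r , root) =
  linear r , cofactor a₃ a₁ r , s≤s z≤n , cofactor-nonconstant a₁ r a₃≢0 ,
  cubic-factor a₃ a₁ a₀ r root

nonic : F₃ → Poly
nonic b = (-₃ b) ∷ 1₃ ∷ 0₃ ∷ 1₃ ∷ 0₃ ∷ 0₃ ∷ 0₃ ∷ 0₃ ∷ 0₃ ∷ 1₃ ∷ []

-- For a ≠ 0 the second iterate of a(X³ − X) − b is X⁹ + X³ + X − b:
-- a² = 1 and the Frobenius x ↦ x³ is additive on 𝔽₃[X].
second-iterate : (a : F₃) → a ≢ 0₃ → (b : F₃) → iter (cubic a a b) 2 ≈ₚ nonic b
second-iterate = from-yes (∀₃? λ a → ¬? (a ≟₃ 0₃) →-dec ∀₃? λ b →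
  iter (cubic a a b) 2 ≈? nonic b)

nonic-reducible : (b : F₃) → Reducible (nonic b)
nonic-reducible 0₃ = Xₚ , (1₃ ∷ 0₃ ∷ 1₃ ∷ 0₃ ∷ 0₃ ∷ 0₃ ∷ 0₃ ∷ 0₃ ∷ 1₃ ∷ []) , s≤s z≤n , s≤s z≤n , refl
nonic-reducible 1₃ = (1₃ ∷ 0₃ ∷ 2₃ ∷ 1₃ ∷ []) , (2₃ ∷ 1₃ ∷ 2₃ ∷ 0₃ ∷ 1₃ ∷ 1₃ ∷ 1₃ ∷ []) , s≤s z≤n , s≤s z≤n , refl
nonic-reducible 2₃ = (1₃ ∷ 2₃ ∷ 1₃ ∷ 1₃ ∷ []) , (1₃ ∷ 2₃ ∷ 1₃ ∷ 2₃ ∷ 2₃ ∷ 2₃ ∷ 1₃ ∷ []) , s≤s z≤n , s≤s z≤n , refl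

reducible-resp-≈ : {f g : Poly} → f ≈ₚ g → Reducible f → Reducible g
reducible-resp-≈ f≈g (u , v , deg-u , deg-v , uv≈f) = u , v , deg-u , deg-v , trans uv≈f f≈g

-- If a₁ = a₃ the second iterate of f is reducible.  The implicit arguments
-- are supplied so that type checking never unfolds the iterate symbolically.
equal⇒second-reducible : (a b : F₃) → a ≢ 0₃ → Reducible (iter (cubic a a b) 2)
equal⇒second-reducible a b a≢0 =
  reducible-resp-≈ {nonic b} {iter (cubic a a b) 2} (sym (second-iterate a a≢0 b)) (nonic-reducible b)

reducible-or-second : (a₃ a₁ a₀ : F₃) → a₃ ≢ 0₃ → Dec (a₁ ≡ a₃) →
  Reducible (cubic a₃ a₁ a₀) ⊎ Reducible (iter (cubic a₃ a₁ a₀) 2)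
reducible-or-second a₃ a₁  a₀ a₃≢0 (no a₁≢a₃) = inj₁ (root⇒reducible a₃ a₁ a₀ a₃≢0 (cubic-root a₃ a₁ a₀ a₁≢a₃))
reducible-or-second a₃ .a₃ a₀ a₃≢0 (yes refl) = inj₂ (equal⇒second-reducible a₃ a₀ a₃≢0)

theorem4p3 : (a₃ a₁ a₀ : F₃) → a₃ ≢ 0₃ →
    Reducible (cubic a₃ a₁ a₀) ⊎ Reducible (iter (cubic a₃ a₁ a₀) 2) ⊎ Reducible (iter (cubic a₃ a₁ a₀) 3)
theorem4p3 a₃ a₁ a₀ a₃≢0 = map₂ inj₁ (reducible-or-second a₃ a₁ a₀ a₃≢0 (a₁ ≟₃ a₃))
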